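{- Let $d\ge1$, $b\ge2$, and let $a_1,\dots,a_d$ be positive integers coprime to $b$. Define $S^{ -1}(t):=(I-T^{a_1})(I-T^{a_2})\cdots(I-T^{a_d})\,\delta_{\mathbb{Z}}(t/b)$ for $t\in\mathbb{Z}$. Let $M$ be the $b\times b$ matrix whose entry in row $i$ and column $j$ is $S^{ -1}(i+1-j)$ for $1\le i\le b-1$, $1\le j\le b$, and whose last row ($i=b$) consists entirely of $1$'s; that is, \[M=\begin{pmatrix} S^{ -1}(1)&S^{ -1}(0)&\cdots&S^{ -1}(2-b)\\ S^{ -1}(2)&S^{ -1}(1)&\cdots&S^{ -1}(3-b)\\ \vdots&\vdots&\ddots&\vdots\\ S^{ -1}(b-1)&S^{ -1}(b-2)&\cdots&S^{ -1}(0)\\ 1&1&\cdots&1\end{pmatrix}.\] Then $\det M=(-1)^{b-1}b^d$.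
   Context: $\delta_{\mathbb{Z}}(x)=1$ if $x\in\mathbb{Z}$ and $0$ otherwise; $I$ is the identity operator and $(T^ah)(t)=h(t+a)$. -}

module Defs where

open import Data.Nat as ℕ using (ℕ; zero; suc)
open import Data.Nat.Divisibility using (_∣?_)
open import Data.Integer using (ℤ; +_; _+_; _-_; _*_; -_; ∣_∣; _^_)
open import Data.Fin using (Fin; zero; suc; toℕ; punchIn)
open import Data.Vec using (Vec; []; _∷_)
open import Data.Bool using (if_then_else_)
open import Relation.Nullary using (does)

-- δ_ℤ(t / b) : 1 if b divides t, 0 otherwise  (b ∣ t in ℤ iff b ∣ |t| in ℕ)
δℤdiv : ℕ → ℤ → ℤ
δℤdiv b t = if does (b ∣? ∣ t ∣) then + 1 else + 0

-- (I - T^a) h,  with (T^a h)(t) = h(t + a)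
I-T : ℕ → (ℤ → ℤ) → (ℤ → ℤ)
I-T a h t = h t - h (t + + a)

Sinv : ∀ {d} → ℕ → Vec ℕ d → ℤ → ℤ
Sinv b []       = δℤdiv b
Sinv b (a ∷ as) = I-T a (Sinv b as)

∑ : ∀ n → (Fin n → ℤ) → ℤ
∑ zero    f = + 0
∑ (suc n) f = f zero + ∑ n (λ i → f (suc i))

det : ∀ n → (Fin n → Fin n → ℤ) → ℤ
det zero    M = + 1
det (suc n) M = ∑ (suc n) (λ j → ((- + 1) ^ toℕ j) * M zero j * det n (λ r c → M (suc r) (punchIn j c)))

-- the b×b matrix M (0-indexed rows i, columns j):
-- rows i < b-1 have entry S⁻¹((i+1) + 1 - (j+1)) = S⁻¹(i + 1 - j); the last row is all 1's
matM : ∀ {d} (b : ℕ) → Vec ℕ d → Fin b → Fin b → ℤ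
matM b as i j =
  if toℕ i ℕ.≡ᵇ (b ℕ.∸ 1) then + 1
  else Sinv b as ((+ toℕ i + + 1) - + toℕ j)

-- For b-periodic g write R t for the row j ↦ g (t − j): it depends on t mod b only, and
-- R 1 + ⋯ + R b is a constant row. The rows of M[(I − T^a) g] are R t − R (t + a). As a is invertible
-- mod b, listing them along t ≡ a, 2a, …, (b − 1)a exhibits them as v m − v (m + 1) with v m = R (m a),
-- and row operations telescope them into R t − R b. Together with the last row of ones and the
-- constant row sum, this gives det M[(I − T^a) g] = b · det M[ g ]. Applying it to a₁, …, a_d leaves
-- g = δ, for which M has ones on the superdiagonal and in its last row and determinant (−1)^(b−1).

module Submission where

open import Defs
open import Data.Bool using (if_then_else_)
open import Data.Fin using (Fin; zero; suc; toℕ; fromℕ; fromℕ<; inject₁; punchIn; punchOut; _≟_)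
import Data.Fin.Properties as FinP
open import Data.Integer as ℤ using (ℤ; +_; -_; _+_; _-_; _*_; _^_; ∣_∣)
import Data.Integer.Properties as ℤP
open import Algebra.Properties.Semiring.Sum ℤP.+-*-semiring
  using (sum; sum-cong-≗; sum-remove; sum-init-last; ∑-distrib-+; ∑-comm; *-distribˡ-sum)
open import Data.Integer.Divisibility.Signed using (∣ᵤ⇒∣; ∣⇒∣ᵤ; ∣m+n∣n⇒∣m; ∣m∣n⇒∣m+n; ∣-refl)
open import Data.Integer.Tactic.RingSolver using (solve-∀)
import Data.Nat
open import Data.Nat as ℕ using (ℕ; zero; suc; _∸_; _%_; _/_; _≡ᵇ_; NonZero; _≤_; z≤n; s≤s)
open import Data.Nat.Coprimality using (Coprime; coprime-Bézout)
open import Data.Nat.DivMod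
  using (m≡m%n+[m/n]*n; %-distribˡ-*; %-distribˡ-+; m%n%n≡m%n; m%n<n; m<n⇒m%n≡m; m*n%n≡0; n%n≡0; [m+kn]%n≡m%n)
import Data.Nat.Divisibility as ℕDiv
open import Data.Nat.GCD using (module Bézout)
import Data.Nat.Properties as ℕP
import Data.Nat.Tactic.RingSolver as ℕ-Solver
open import Data.Product using (∃-syntax; _,_)
open import Data.Sum using (inj₁; inj₂; [_,_]′)
open import Data.Vec using (Vec; []; _∷_; lookup)
open import Data.Vec.Functional using (updateAt)
open import Data.Vec.Functional.Properties using (updateAt-updates; updateAt-minimal; updateAt-id-local)
open import Function using (_∘_; const; mk⇔)
open import Relation.Binary.Definitions using (tri<; tri≈; tri>)
open import Relation.Binary.PropositionalEquality
open import Relation.Nullary using (yes; no; does; ¬_)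
open import Relation.Nullary.Decidable using (dec-true; dec-false; does-⇔)
open import Relation.Nullary.Negation using (contradiction)

∑≡sum : ∀ n (f : Fin n → ℤ) → ∑ n f ≡ sum f
∑≡sum zero    f = refl
∑≡sum (suc n) f = cong (_+_ (f zero)) (∑≡sum n (f ∘ suc))

sum-linear : ∀ {n} (c d : ℤ) (f g : Fin n → ℤ) →
             sum (λ j → c * f j + d * g j) ≡ c * sum f + d * sum g
sum-linear c d f g = trans (∑-distrib-+ (λ j → c * f j) (λ j → d * g j))
  (sym (cong₂ _+_ (*-distribˡ-sum c f) (*-distribˡ-sum d g)))

sum-zero : ∀ {n} {f : Fin n → ℤ} → (∀ i → f i ≡ + 0) → sum f ≡ + 0
sum-zero {zero}  f≡0 = refl
sum-zero {suc n} f≡0 = cong₂ _+_ (f≡0 zero) (sum-zero (f≡0 ∘ suc))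

sum-neg : ∀ {n} (f : Fin n → ℤ) → sum (λ i → - f i) ≡ - sum f
sum-neg {zero}  f = refl
sum-neg {suc n} f = trans (cong (_+_ (- f zero)) (sum-neg (f ∘ suc)))
  (sym (ℤP.neg-distrib-+ (f zero) (sum (f ∘ suc))))

sum-minus-const : ∀ {n} (f : Fin n → ℤ) (c : ℤ) → sum (λ i → f i - c) ≡ sum f - + n * c
sum-minus-const {zero}  f c = sym (cong (λ x → + 0 - x) (ℤP.*-zeroˡ c))
sum-minus-const {suc n} f c = trans (cong (_+_ (f zero - c)) (sum-minus-const (f ∘ suc) c))
                                     (regroup (f zero) (sum (f ∘ suc)) (+ n) c)
  where
  regroup : ∀ x S m c → x - c + (S - m * c) ≡ x + S - (+ 1 + m) * c
  regroup = solve-∀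

sum-single : ∀ {n} (f : Fin n → ℤ) (k : Fin n) → (∀ i → i ≢ k → f i ≡ + 0) → sum f ≡ f k
sum-single {suc n} f k f≡0 = begin
  sum f                               ≡⟨ sum-remove f ⟩
  f k + sum (f ∘ punchIn k)           ≡⟨ cong (_+_ (f k)) (sum-zero (λ c → f≡0 _ (FinP.punchInᵢ≢i k c))) ⟩
  f k + + 0                           ≡⟨ ℤP.+-identityʳ (f k) ⟩
  f k                                 ∎
  where open ≡-Reasoning

-- Multilinearity and alternation of det

Mat : ℕ → Set
Mat n = Fin n → Fin n → ℤ

sign : ℕ → ℤ
sign k = (- + 1) ^ k

minor : ∀ {n} → Mat (suc n) → Fin (suc n) → Mat n
minor M j r c = M (suc r) (punchIn j c)

expansionTerm : ∀ {n} → Mat (suc n) → Fin (suc n) → ℤ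
expansionTerm {n} M j = sign (toℕ j) * M zero j * det n (minor M j)

det-expand : ∀ {n} (M : Mat (suc n)) → det (suc n) M ≡ sum (expansionTerm M)
det-expand {n} M = ∑≡sum (suc n) (expansionTerm M)

det-cong : ∀ {n} {A B : Mat n} → (∀ i j → A i j ≡ B i j) → det n A ≡ det n B
det-cong {zero}  A≡B = refl
det-cong {suc n} {A} {B} A≡B = begin
  det (suc n) A            ≡⟨ det-expand A ⟩
  sum (expansionTerm A)    ≡⟨ sum-cong-≗ (λ j → cong₂ (λ x y → sign (toℕ j) * x * y) (A≡B zero j)
                                                 (det-cong (λ r c → A≡B (suc r) (punchIn j c)))) ⟩
  sum (expansionTerm B)    ≡⟨ det-expand B ⟨
  det (suc n) B            ∎
  where open ≡-Reasoning

SameRowsExcept : ∀ {n} → Fin n → Mat n → Mat n → Set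
SameRowsExcept p A B = ∀ r → r ≢ p → ∀ j → A r j ≡ B r j

minor-sameRowsExcept : ∀ {n} {p : Fin n} {A B : Mat (suc n)} → SameRowsExcept (suc p) A B →
                       ∀ k → SameRowsExcept p (minor A k) (minor B k)
minor-sameRowsExcept A~B k r r≢p c = A~B (suc r) (r≢p ∘ FinP.suc-injective) (punchIn k c)

sameRowsExcept₀⇒minor≡ : ∀ {n} {A B : Mat (suc n)} → SameRowsExcept zero A B →
             ∀ k i j → minor A k i j ≡ minor B k i j
sameRowsExcept₀⇒minor≡ A~B k r c = A~B (suc r) (λ ()) (punchIn k c)

det-linear : ∀ {n} (p : Fin n) (c d : ℤ) {A B C : Mat n} →
             SameRowsExcept p A C → SameRowsExcept p B C → (∀ j → C p j ≡ c * A p j + d * B p j) →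
             det n C ≡ c * det n A + d * det n B
det-linear {suc n} p c d {A} {B} {C} A~C B~C Cp = begin
  det (suc n) C                                                     ≡⟨ det-expand C ⟩
  sum (expansionTerm C)                                             ≡⟨ sum-cong-≗ (term-linear p A~C B~C Cp) ⟩
  sum (λ j → c * expansionTerm A j + d * expansionTerm B j)         ≡⟨ sum-linear c d (expansionTerm A) (expansionTerm B) ⟩
  c * sum (expansionTerm A) + d * sum (expansionTerm B)             ≡⟨ cong₂ (λ x y → c * x + d * y) (det-expand A) (det-expand B) ⟨
  c * det (suc n) A + d * det (suc n) B                             ∎
  where
  open ≡-Reasoning
  term-linear : ∀ p → SameRowsExcept p A C → SameRowsExcept p B C → (∀ j → C p j ≡ c * A p j + d * B p j) →
                ∀ j → expansionTerm C j ≡ c * expansionTerm A j + d * expansionTerm B j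
  term-linear zero A~C B~C Cp j = begin
    s * C zero j * x                                  ≡⟨ cong (λ e → s * e * x) (Cp j) ⟩
    s * (c * A zero j + d * B zero j) * x             ≡⟨ distrib s c d (A zero j) (B zero j) x ⟩
    c * (s * A zero j * x) + d * (s * B zero j * x)   ≡⟨ cong₂ (λ y z → c * (s * A zero j * y) + d * (s * B zero j * z))
                                                          (det-cong (sameRowsExcept₀⇒minor≡ (λ r r≢0 → sym ∘ A~C r r≢0) j))
                                                          (det-cong (sameRowsExcept₀⇒minor≡ (λ r r≢0 → sym ∘ B~C r r≢0) j)) ⟩
    c * expansionTerm A j + d * expansionTerm B j     ∎
    where
    s = sign (toℕ j)
    x = det n (minor C j)
    distrib : ∀ s c d a b x → s * (c * a + d * b) * x ≡ c * (s * a * x) + d * (s * b * x)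
    distrib = solve-∀
  term-linear (suc p) A~C B~C Cp j = begin
    s * C zero j * det n (minor C j)                                        ≡⟨ cong₂ (λ e y → s * e * y) (sym (A~C zero (λ ()) j))
                                                                                (det-linear p c d (minor-sameRowsExcept A~C j)
                                                                                  (minor-sameRowsExcept B~C j) (Cp ∘ punchIn j)) ⟩
    s * A zero j * (c * det n (minor A j) + d * det n (minor B j))          ≡⟨ distrib s (A zero j) c d _ _ ⟩
    c * expansionTerm A j + d * (s * A zero j * det n (minor B j))
      ≡⟨ cong (λ e → c * expansionTerm A j + d * (s * e * det n (minor B j)))
                                                                                (trans (A~C zero (λ ()) j) (sym (B~C zero (λ ()) j))) ⟩
    c * expansionTerm A j + d * expansionTerm B j                           ∎
    where
    s = sign (toℕ j)
    distrib : ∀ s a c d x y → s * a * (c * x + d * y) ≡ c * (s * a * x) + d * (s * a * y)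
    distrib = solve-∀

det-scale : ∀ {n} (p : Fin n) (c : ℤ) {A C : Mat n} → SameRowsExcept p A C →
            (∀ j → C p j ≡ c * A p j) → det n C ≡ c * det n A
det-scale {n} p c {A} A~C Cp =
  trans (det-linear p c (+ 0) A~C A~C (λ j → trans (Cp j) (drop-zero (c * A p j) (A p j))))
        (sym (drop-zero (c * det n A) (det n A)))
  where
  drop-zero : ∀ x y → x ≡ x + + 0 * y
  drop-zero = solve-∀

pairMinor : ∀ {m} → Mat (suc (suc m)) → Fin (suc (suc m)) → Fin (suc m) → Mat m
pairMinor M k l r c = M (suc (suc r)) (punchIn k (punchIn l c))

pairTerm : ∀ {m} → Mat (suc (suc m)) → Fin (suc (suc m)) → Fin (suc (suc m)) → ℤ
pairTerm {m} M k l with k ≟ l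
... | yes _  = + 0
... | no k≢l = sign (toℕ k) * sign (toℕ (punchOut k≢l)) * M zero k * M (suc zero) l
               * det m (pairMinor M k (punchOut k≢l))

pairTerm-diag : ∀ {m} (M : Mat (suc (suc m))) k → pairTerm M k k ≡ + 0
pairTerm-diag M k with k ≟ k
... | yes _   = refl
... | no k≢k  = contradiction refl k≢k

pairTerm-punchIn : ∀ {m} (M : Mat (suc (suc m))) k c →
                   pairTerm M k (punchIn k c) ≡ sign (toℕ k) * M zero k * expansionTerm (minor M k) c
pairTerm-punchIn {m} M k c with k ≟ punchIn k c
... | yes k≡l  = contradiction (sym k≡l) (FinP.punchInᵢ≢i k c)
... | no k≢l = trans (cong (λ z → sign (toℕ k) * sign (toℕ z) * M zero k * M (suc zero) (punchIn k c)
                                  * det m (pairMinor M k z))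
                           (trans (FinP.punchOut-cong k refl) (FinP.punchOut-punchIn k)))
                     (reassoc (sign (toℕ k)) (sign (toℕ c)) (M zero k) (M (suc zero) (punchIn k c))
                              (det m (pairMinor M k c)))
  where
  reassoc : ∀ s t a b x → s * t * a * b * x ≡ s * a * (t * b * x)
  reassoc = solve-∀

det-expand₂ : ∀ {m} (M : Mat (suc (suc m))) → det (suc (suc m)) M ≡ sum (λ k → sum (pairTerm M k))
det-expand₂ {m} M = trans (det-expand M) (sum-cong-≗ expand-minor)
  where
  open ≡-Reasoning
  expand-minor : ∀ k → expansionTerm M k ≡ sum (pairTerm M k)
  expand-minor k = begin
    sign (toℕ k) * M zero k * det (suc m) (minor M k)
      ≡⟨ cong (sign (toℕ k) * M zero k *_) (det-expand (minor M k)) ⟩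
    sign (toℕ k) * M zero k * sum (expansionTerm (minor M k))
      ≡⟨ *-distribˡ-sum (sign (toℕ k) * M zero k) (expansionTerm (minor M k)) ⟩
    sum (λ c → sign (toℕ k) * M zero k * expansionTerm (minor M k) c)
      ≡⟨ sum-cong-≗ (sym ∘ pairTerm-punchIn M k) ⟩
    sum (pairTerm M k ∘ punchIn k)
      ≡⟨ ℤP.+-identityˡ _ ⟨
    + 0 + sum (pairTerm M k ∘ punchIn k)
      ≡⟨ cong (_+ sum (pairTerm M k ∘ punchIn k)) (pairTerm-diag M k) ⟨
    pairTerm M k k + sum (pairTerm M k ∘ punchIn k)
      ≡⟨ sum-remove (pairTerm M k) ⟨
    sum (pairTerm M k) ∎

sign-punchOut-antisym : ∀ {n} {k l : Fin (suc n)} (k≢l : k ≢ l) (l≢k : l ≢ k) →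
  sign (toℕ k) * sign (toℕ (punchOut k≢l)) ≡ - (sign (toℕ l) * sign (toℕ (punchOut l≢k)))
sign-punchOut-antisym {_}     {zero}  {zero}  k≢l _ = contradiction refl k≢l
sign-punchOut-antisym {suc n} {zero}  {suc l} _   _ = flip-sign (sign (toℕ l))
  where
  flip-sign : ∀ x → + 1 * x ≡ - (- + 1 * x * + 1)
  flip-sign = solve-∀
sign-punchOut-antisym {suc n} {suc k} {zero}  _   _ = flip-sign (sign (toℕ k))
  where
  flip-sign : ∀ x → - + 1 * x * + 1 ≡ - (+ 1 * x)
  flip-sign = solve-∀
sign-punchOut-antisym {suc n} {suc k} {suc l} k≢l l≢k =
  trans (negate-both (sign (toℕ k)) (sign (toℕ (punchOut (k≢l ∘ cong suc)))))
        (trans (sign-punchOut-antisym (k≢l ∘ cong suc) (l≢k ∘ cong suc))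
               (cong -_ (sym (negate-both (sign (toℕ l)) (sign (toℕ (punchOut (l≢k ∘ cong suc))))))))
  where
  negate-both : ∀ x y → - + 1 * x * (- + 1 * y) ≡ x * y
  negate-both = solve-∀

punchIn-punchOut-comm : ∀ {n} {k l : Fin (suc (suc n))} (k≢l : k ≢ l) (l≢k : l ≢ k) (c : Fin n) →
                        punchIn k (punchIn (punchOut k≢l) c) ≡ punchIn l (punchIn (punchOut l≢k) c)
punchIn-punchOut-comm {_}     {zero}  {zero}  k≢l _   c       = contradiction refl k≢l
punchIn-punchOut-comm {_}     {zero}  {suc l} _   _   c       = refl
punchIn-punchOut-comm {_}     {suc k} {zero}  _   _   c       = refl
punchIn-punchOut-comm {suc n} {suc k} {suc l} _   _   zero    = refl
punchIn-punchOut-comm {suc n} {suc k} {suc l} k≢l l≢k (suc c) =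
  cong suc (punchIn-punchOut-comm (k≢l ∘ cong suc) (l≢k ∘ cong suc) c)

module _ {m} {A C : Mat (suc (suc m))}
         (C₀≡A₁ : ∀ j → C zero j ≡ A (suc zero) j) (C₁≡A₀ : ∀ j → C (suc zero) j ≡ A zero j)
         (C≡A : ∀ r j → C (suc (suc r)) j ≡ A (suc (suc r)) j) where

  pairTerm-swap₀₁ : ∀ k l → pairTerm C k l ≡ - pairTerm A l k
  pairTerm-swap₀₁ k l with k ≟ l | l ≟ k
  ... | yes _   | yes _   = refl
  ... | yes k≡l | no l≢k  = contradiction (sym k≡l) l≢k
  ... | no k≢l  | yes l≡k = contradiction (sym l≡k) k≢l
  ... | no k≢l  | no l≢k  = begin
    s * C zero k * C (suc zero) l * det m (pairMinor C k (punchOut k≢l))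
      ≡⟨ cong₂ (λ x y → s * x * y * det m (pairMinor C k (punchOut k≢l))) (C₀≡A₁ k) (C₁≡A₀ l) ⟩
    s * A (suc zero) k * A zero l * det m (pairMinor C k (punchOut k≢l))
      ≡⟨ cong₂ (λ x y → x * A (suc zero) k * A zero l * y) (sign-punchOut-antisym k≢l l≢k)
               (det-cong (λ r c → trans (C≡A r _) (cong (A (suc (suc r))) (punchIn-punchOut-comm k≢l l≢k c)))) ⟩
    - t * A (suc zero) k * A zero l * det m (pairMinor A l (punchOut l≢k))
      ≡⟨ rearrange t (A (suc zero) k) (A zero l) _ ⟩
    - (t * A zero l * A (suc zero) k * det m (pairMinor A l (punchOut l≢k))) ∎
    where
    open ≡-Reasoning
    s = sign (toℕ k) * sign (toℕ (punchOut k≢l))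
    t = sign (toℕ l) * sign (toℕ (punchOut l≢k))
    rearrange : ∀ t a b x → - t * a * b * x ≡ - (t * b * a * x)
    rearrange = solve-∀

  det-swap₀₁ : det (suc (suc m)) C ≡ - det (suc (suc m)) A
  det-swap₀₁ = begin
    det (suc (suc m)) C                            ≡⟨ det-expand₂ C ⟩
    sum (λ k → sum (λ l → pairTerm C k l))         ≡⟨ sum-cong-≗ (λ k → sum-cong-≗ (pairTerm-swap₀₁ k)) ⟩
    sum (λ k → sum (λ l → - pairTerm A l k))       ≡⟨ sum-cong-≗ (λ k → sum-neg (λ l → pairTerm A l k)) ⟩
    sum (λ k → - sum (λ l → pairTerm A l k))       ≡⟨ sum-neg (λ k → sum (λ l → pairTerm A l k)) ⟩
    - sum (λ k → sum (λ l → pairTerm A l k))       ≡⟨ cong -_ (∑-comm (λ l k → pairTerm A l k)) ⟨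
    - sum (λ l → sum (λ k → pairTerm A l k))       ≡⟨ cong -_ (det-expand₂ A) ⟨
    - det (suc (suc m)) A                          ∎
    where open ≡-Reasoning

det-swap-adjacent : ∀ {n} (i : Fin n) {A C : Mat (suc n)} →
                    (∀ c → C (inject₁ i) c ≡ A (suc i) c) → (∀ c → C (suc i) c ≡ A (inject₁ i) c) →
                    (∀ r → r ≢ inject₁ i → r ≢ suc i → ∀ c → C r c ≡ A r c) →
                    det (suc n) C ≡ - det (suc n) A
det-swap-adjacent {suc m} zero {A} {C} C₀≡A₁ C₁≡A₀ C≡A =
  det-swap₀₁ {A = A} {C = C} C₀≡A₁ C₁≡A₀ (λ r → C≡A (suc (suc r)) (λ ()) (λ ()))
det-swap-adjacent {suc m} (suc i) {A} {C} C≡A' C'≡A C≡A = begin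
  det (suc (suc m)) C               ≡⟨ det-expand C ⟩
  sum (expansionTerm C)             ≡⟨ sum-cong-≗ term-negated ⟩
  sum (λ k → - expansionTerm A k)   ≡⟨ sum-neg (expansionTerm A) ⟩
  - sum (expansionTerm A)           ≡⟨ cong -_ (det-expand A) ⟨
  - det (suc (suc m)) A             ∎
  where
  open ≡-Reasoning
  minor-swapped : ∀ k → det (suc m) (minor C k) ≡ - det (suc m) (minor A k)
  minor-swapped k = det-swap-adjacent i (C≡A' ∘ punchIn k) (C'≡A ∘ punchIn k)
    (λ r r≢i r≢i' c → C≡A (suc r) (r≢i ∘ FinP.suc-injective) (r≢i' ∘ FinP.suc-injective) (punchIn k c))
  term-negated : ∀ k → expansionTerm C k ≡ - expansionTerm A k
  term-negated k = trans (cong₂ (λ x y → sign (toℕ k) * x * y) (C≡A zero (λ ()) (λ ()) k) (minor-swapped k))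
                         (sym (ℤP.neg-distribʳ-* (sign (toℕ k) * A zero k) (det (suc m) (minor A k))))

self-negative⇒0 : ∀ {x : ℤ} → x ≡ - x → x ≡ + 0
self-negative⇒0 {+ zero}     _  = refl
self-negative⇒0 {+ suc _}    ()
self-negative⇒0 {ℤ.-[1+ _ ]} ()

_[_]≔_ : ∀ {n} → Mat n → Fin n → (Fin n → ℤ) → Mat n
A [ p ]≔ v = updateAt A p (const v)

row-updated : ∀ {n} (A : Mat n) p v c → (A [ p ]≔ v) p c ≡ v c
row-updated A p v c = cong-app (updateAt-updates p A) c

row-unchanged : ∀ {n} (A : Mat n) {p} v {r} → r ≢ p → ∀ c → (A [ p ]≔ v) r c ≡ A r c
row-unchanged A {p} v {r} r≢p c = cong-app (updateAt-minimal r p A r≢p) c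

swapRows : ∀ {n} → Mat n → Fin n → Fin n → Mat n
swapRows A i j = (A [ i ]≔ A j) [ j ]≔ A i

module _ {n} (A : Mat n) {i j : Fin n} where

  swapRows-first : i ≢ j → ∀ c → swapRows A i j i c ≡ A j c
  swapRows-first i≢j c = trans (row-unchanged _ _ i≢j c) (row-updated A i (A j) c)

  swapRows-second : ∀ c → swapRows A i j j c ≡ A i c
  swapRows-second = row-updated (A [ i ]≔ A j) j (A i)

  swapRows-other : ∀ {r} → r ≢ i → r ≢ j → ∀ c → swapRows A i j r c ≡ A r c
  swapRows-other r≢i r≢j c = trans (row-unchanged _ _ r≢j c) (row-unchanged A _ r≢i c)

-- Induction on the position of the lower row, which an adjacent swap moves up by one.
det-equal-rows-below : ∀ {n} k (A : Mat n) (i j : Fin n) → toℕ j ≡ k → toℕ i ℕ.< k →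
                       (∀ c → A i c ≡ A j c) → det n A ≡ + 0
det-equal-rows-below (suc k) A i (suc j) j≡k i<k Ai≡Aj with ℕP.m<1+n⇒m<n∨m≡n i<k
... | inj₂ i≡k = self-negative⇒0 (det-swap-adjacent j {A} {A} (λ c → trans (cong (λ r → A r c) (sym i≡j)) (Ai≡Aj c))
                                                      (λ c → sym (trans (cong (λ r → A r c) (sym i≡j)) (Ai≡Aj c)))
                                                      (λ _ _ _ _ → refl))
  where
  i≡j : i ≡ inject₁ j
  i≡j = FinP.toℕ-injective (trans i≡k (sym (trans (FinP.toℕ-inject₁ j) (ℕP.suc-injective j≡k))))
... | inj₁ i<k' = begin
  det _ A              ≡⟨ ℤP.neg-involutive (det _ A) ⟨
  - - det _ A          ≡⟨ cong -_ (det-swap-adjacent j (swapRows-first A j'≢j) (swapRows-second A {inject₁ j} {suc j})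
                                                     (λ _ → swapRows-other A)) ⟨
  - det _ A'           ≡⟨ cong -_ (det-equal-rows-below k A' i (inject₁ j) j'≡k i<k' A'i≡A'j') ⟩
  - + 0                ∎
  where
  open ≡-Reasoning
  A' = swapRows A (inject₁ j) (suc j)
  j'≡k : toℕ (inject₁ j) ≡ k
  j'≡k = trans (FinP.toℕ-inject₁ j) (ℕP.suc-injective j≡k)
  j'≢j : inject₁ j ≢ suc j
  j'≢j e = ℕP.<⇒≢ (ℕP.n<1+n (toℕ j)) (trans (sym (FinP.toℕ-inject₁ j)) (cong toℕ e))
  A'i≡A'j' : ∀ c → A' i c ≡ A' (inject₁ j) c
  A'i≡A'j' c = trans (swapRows-other A (λ e → ℕP.<⇒≢ i<k' (trans (cong toℕ e) j'≡k))
                                        (λ e → ℕP.<⇒≢ i<k (trans (cong toℕ e) j≡k)) c)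
                     (trans (Ai≡Aj c) (sym (swapRows-first A j'≢j c)))

det-equal-rows : ∀ {n} (A : Mat n) {i j : Fin n} → i ≢ j → (∀ c → A i c ≡ A j c) → det n A ≡ + 0
det-equal-rows A {i} {j} i≢j Ai≡Aj with ℕP.<-cmp (toℕ i) (toℕ j)
... | tri< i<j _ _ = det-equal-rows-below (toℕ j) A i j refl i<j Ai≡Aj
... | tri≈ _ i≡j _ = contradiction (FinP.toℕ-injective i≡j) i≢j
... | tri> _ _ j<i = det-equal-rows-below (toℕ i) A j i refl j<i (sym ∘ Ai≡Aj)

-- Row operations

det-add-multiple : ∀ {n} {p q : Fin n} (c : ℤ) {A C : Mat n} → p ≢ q → SameRowsExcept p A C →
                   (∀ j → C p j ≡ A p j + c * A q j) → det n C ≡ det n A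
det-add-multiple {n} {p} {q} c {A} {C} p≢q A~C Cp = begin
  det n C                                    ≡⟨ det-linear p (+ 1) c A~C B~C (λ j → trans (Cp j) (Cp≡ j)) ⟩
  + 1 * det n A + c * det n B                ≡⟨ cong (λ x → + 1 * det n A + c * x) (det-equal-rows B p≢q Bp≡Bq) ⟩
  + 1 * det n A + c * + 0                    ≡⟨ simplify (det n A) c ⟩
  det n A                                    ∎
  where
  open ≡-Reasoning
  B : Mat n
  B = A [ p ]≔ A q
  B~C : SameRowsExcept p B C
  B~C r r≢p j = trans (row-unchanged A (A q) r≢p j) (A~C r r≢p j)
  Bp≡Bq : ∀ j → B p j ≡ B q j
  Bp≡Bq j = trans (row-updated A p (A q) j) (sym (row-unchanged A (A q) (p≢q ∘ sym) j))
  Cp≡ : ∀ j → A p j + c * A q j ≡ + 1 * A p j + c * B p j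
  Cp≡ j = cong₂ (λ x y → x + c * y) (sym (ℤP.*-identityˡ (A p j))) (sym (row-updated A p (A q) j))
  simplify : ∀ x c → + 1 * x + c * + 0 ≡ x
  simplify = solve-∀

det-row-sum : ∀ {n} (p : Fin n) {K} (v : Fin K → Fin n → ℤ) {A C : Mat n} → SameRowsExcept p A C →
              (∀ j → C p j ≡ sum (λ k → v k j)) → det n C ≡ sum (λ k → det n (A [ p ]≔ v k))
det-row-sum {n} p {zero} v {A} {C} A~C Cp =
  trans (det-scale p (+ 0) A~C (λ j → trans (Cp j) (sym (ℤP.*-zeroˡ (A p j))))) (ℤP.*-zeroˡ (det n A))
det-row-sum {n} p {suc K} v {A} {C} A~C Cp = begin
  det n C                                  ≡⟨ det-linear p (+ 1) (+ 1) (updated~C (v zero)) (updated~C rest) Cp≡ ⟩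
  + 1 * det n (A [ p ]≔ v zero) + + 1 * det n (A [ p ]≔ rest)
      ≡⟨ cong₂ _+_ (ℤP.*-identityˡ (det n (A [ p ]≔ v zero))) (ℤP.*-identityˡ (det n (A [ p ]≔ rest))) ⟩
  det n (A [ p ]≔ v zero) + det n (A [ p ]≔ rest)
      ≡⟨ cong (_+_ (det n (A [ p ]≔ v zero)))
              (det-row-sum p (v ∘ suc) (λ r r≢p j → sym (row-unchanged A rest r≢p j)) (row-updated A p rest)) ⟩
  sum (λ k → det n (A [ p ]≔ v k))         ∎
  where
  open ≡-Reasoning
  rest : Fin n → ℤ
  rest j = sum (λ k → v (suc k) j)
  updated~C : ∀ w → SameRowsExcept p (A [ p ]≔ w) C
  updated~C w r r≢p j = trans (row-unchanged A w r≢p j) (A~C r r≢p j)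
  Cp≡ : ∀ j → C p j ≡ + 1 * (A [ p ]≔ v zero) p j + + 1 * (A [ p ]≔ rest) p j
  Cp≡ j = trans (Cp j) (sym (cong₂ _+_ (trans (ℤP.*-identityˡ _) (row-updated A p (v zero) j))
                                       (trans (ℤP.*-identityˡ _) (row-updated A p rest j))))

det-combination : ∀ {n} (p : Fin n) (w : Fin n → ℤ) {A C : Mat n} → SameRowsExcept p A C →
                  (∀ j → C p j ≡ sum (λ q → w q * A q j)) → det n C ≡ w p * det n A
det-combination {n} p w {A} {C} A~C Cp = begin
  det n C                                          ≡⟨ det-row-sum p (λ q j → w q * A q j) A~C Cp ⟩
  sum (λ q → det n (A [ p ]≔ (λ j → w q * A q j))) ≡⟨ sum-cong-≗ scaled ⟩
  sum (λ q → w q * det n (A [ p ]≔ A q))           ≡⟨ sum-single _ p off-p ⟩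
  w p * det n (A [ p ]≔ A p)                       ≡⟨ cong (w p *_) (det-cong (λ r → cong-app (updateAt-id-local p A refl r))) ⟩
  w p * det n A                                    ∎
  where
  open ≡-Reasoning
  scaled : ∀ q → det n (A [ p ]≔ (λ j → w q * A q j)) ≡ w q * det n (A [ p ]≔ A q)
  scaled q = det-scale p (w q) (λ r r≢p j → trans (row-unchanged A (A q) r≢p j) (sym (row-unchanged A _ r≢p j)))
                       (λ j → trans (row-updated A p _ j) (cong (w q *_) (sym (row-updated A p (A q) j))))
  off-p : ∀ q → q ≢ p → w q * det n (A [ p ]≔ A q) ≡ + 0
  off-p q q≢p = trans (cong (w q *_) (det-equal-rows (A [ p ]≔ A q) (q≢p ∘ sym)
                          (λ j → trans (row-updated A p (A q) j) (sym (row-unchanged A (A q) q≢p j)))))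
                      (ℤP.*-zeroʳ (w q))

splice : ∀ {n} → (Fin n → ℕ) → ℕ → Mat n → Mat n → Mat n
splice rank k C A r = if does (rank r ℕ.<? k) then C r else A r

module _ {n} (rank : Fin n → ℕ) (C A : Mat n) {k : ℕ} {r : Fin n} where

  splice-below : rank r ℕ.< k → ∀ j → splice rank k C A r j ≡ C r j
  splice-below r<k j = cong (λ b → (if b then C r else A r) j) (dec-true (rank r ℕ.<? k) r<k)

  splice-above : ¬ rank r ℕ.< k → ∀ j → splice rank k C A r j ≡ A r j
  splice-above r≮k j = cong (λ b → (if b then C r else A r) j) (dec-false (rank r ℕ.<? k) r≮k)

splice-suc : ∀ {n} (rank : Fin n → ℕ) (C A : Mat n) {k r} → rank r ≢ k →
             ∀ j → splice rank (suc k) C A r j ≡ splice rank k C A r j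
splice-suc rank C A {k} {r} r≢k j with rank r ℕ.<? k
... | yes r<k = trans (splice-below rank C A (ℕP.m<n⇒m<1+n r<k) j) (sym (splice-below rank C A r<k j))
... | no r≮k  = trans (splice-above rank C A (λ r<k' → [ r≮k , r≢k ]′ (ℕP.m<1+n⇒m<n∨m≡n r<k')) j)
                      (sym (splice-above rank C A r≮k j))

det-add-multiples-of-row : ∀ {n} (q : Fin n) (w : Fin n → ℤ) {A C : Mat n} → (∀ j → C q j ≡ A q j) →
                           (∀ r → r ≢ q → ∀ j → C r j ≡ A r j + w r * A q j) → det n C ≡ det n A
det-add-multiples-of-row {n} q w {A} {C} Cq C≡ = begin
  det n C                    ≡⟨ det-cong (λ r → sym ∘ splice-below toℕ C A (FinP.toℕ<n r)) ⟩
  det n (splice toℕ n C A)   ≡⟨ spliced n ℕP.≤-refl ⟩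
  det n A                    ∎
  where
  open ≡-Reasoning
  row-q : ∀ k j → splice toℕ k C A q j ≡ A q j
  row-q k j with toℕ q ℕ.<? k
  ... | yes q<k = trans (splice-below toℕ C A q<k j) (Cq j)
  ... | no q≮k  = splice-above toℕ C A q≮k j
  row-at : ∀ {k} (k<n : k ℕ.< n) {r} → toℕ r ≡ k → r ≡ fromℕ< k<n
  row-at k<n r≡k = FinP.toℕ-injective (trans r≡k (sym (FinP.toℕ-fromℕ< k<n)))
  step : ∀ k (k<n : k ℕ.< n) → det n (splice toℕ (suc k) C A) ≡ det n (splice toℕ k C A)
  step k k<n with fromℕ< k<n ≟ q
  ... | yes P≡q = det-cong same
    where
    same : ∀ r j → splice toℕ (suc k) C A r j ≡ splice toℕ k C A r j
    same r j with toℕ r ℕ.≟ k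
    ... | no r≢k  = splice-suc toℕ C A r≢k j
    ... | yes r≡k rewrite trans (row-at k<n r≡k) P≡q = trans (row-q (suc k) j) (sym (row-q k j))
  ... | no P≢q = det-add-multiple (w P) P≢q
                   (λ r r≢P j → sym (splice-suc toℕ C A (r≢P ∘ row-at k<n) j))
                   (λ j → trans (splice-below toℕ C A (ℕP.≤-reflexive (cong suc toℕP)) j)
                           (trans (C≡ P P≢q j)
                                  (sym (cong₂ (λ x y → x + w P * y)
                                              (splice-above toℕ C A (λ P<k → ℕP.<-irrefl toℕP P<k) j) (row-q k j)))))
    where
    P = fromℕ< k<n
    toℕP : toℕ P ≡ k
    toℕP = FinP.toℕ-fromℕ< k<n
  spliced : ∀ k → k ℕ.≤ n → det n (splice toℕ k C A) ≡ det n A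
  spliced zero    _   = det-cong (λ r → splice-above toℕ C A {k = 0} (λ ()))
  spliced (suc k) k<n = trans (step k k<n) (spliced k (ℕP.<⇒≤ k<n))

-- The row of level m ≥ 1 is v m − v (m + 1). For m = n − 2, …, 1, adding to it the row of level
-- m + 1, already turned into v (m + 1) − v n, turns it into v m − v n; rows of level 0 stay as they are.
module _ {n} (level : Fin n → ℕ) (rowAt : ℕ → Fin n)
         (level-rowAt : ∀ {m} → 0 ℕ.< m → m ℕ.< n → level (rowAt m) ≡ m)
         (rowAt-level : ∀ r → 0 ℕ.< level r → rowAt (level r) ≡ r)
         (level<n : ∀ r → level r ℕ.< n)
         (v : ℕ → Fin n → ℤ) {A : Mat n}
         (A-row : ∀ r → 0 ℕ.< level r → ∀ j → A r j ≡ v (level r) j - v (suc (level r)) j) where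

  private
    telescoped : Mat n
    telescoped r j = v (level r) j - v n j

    stage : ℕ → Mat n
    stage m = splice level m A telescoped

    stage-last : ∀ {m} → 0 ℕ.< m → suc m ≡ n → ∀ r j → stage m r j ≡ stage (suc m) r j
    stage-last {m} 0<m m+1≡n r j with level r ℕ.≟ m
    ... | no r≢m  = sym (splice-suc level A telescoped r≢m j)
    ... | yes r≡m = begin
      stage m r j                            ≡⟨ splice-above level A telescoped (λ r<m → ℕP.<-irrefl r≡m r<m) j ⟩
      v (level r) j - v n j                  ≡⟨ cong (λ l → v (level r) j - v l j) (trans (cong suc r≡m) m+1≡n) ⟨
      v (level r) j - v (suc (level r)) j    ≡⟨ A-row r (subst (0 ℕ.<_) (sym r≡m) 0<m) j ⟨
      A r j                                  ≡⟨ splice-below level A telescoped (ℕP.≤-reflexive (cong suc r≡m)) j ⟨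
      stage (suc m) r j                      ∎
      where open ≡-Reasoning

    stage-add : ∀ {m} → 0 ℕ.< m → suc m ℕ.< n → det n (stage m) ≡ det n (stage (suc m))
    stage-add {m} 0<m m+1<n =
      det-add-multiple (+ 1) P≢Q (λ r r≢P j → splice-suc level A telescoped (r≢P ∘ at-level-m) j) rowP
      where
      open ≡-Reasoning
      P Q : Fin n
      P = rowAt m
      Q = rowAt (suc m)
      levelP : level P ≡ m
      levelP = level-rowAt 0<m (ℕP.<-trans (ℕP.n<1+n m) m+1<n)
      levelQ : level Q ≡ suc m
      levelQ = level-rowAt (ℕ.s≤s ℕ.z≤n) m+1<n
      at-level-m : ∀ {r} → level r ≡ m → r ≡ P
      at-level-m {r} r≡m = trans (sym (rowAt-level r (subst (0 ℕ.<_) (sym r≡m) 0<m))) (cong rowAt r≡m)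
      P≢Q : P ≢ Q
      P≢Q P≡Q = ℕP.<-irrefl (trans (sym levelP) (trans (cong level P≡Q) levelQ)) (ℕP.n<1+n m)
      rowP : ∀ j → stage m P j ≡ stage (suc m) P j + + 1 * stage (suc m) Q j
      rowP j = begin
        stage m P j                                     ≡⟨ splice-above level A telescoped (λ P<m → ℕP.<-irrefl levelP P<m) j ⟩
        v (level P) j - v n j                           ≡⟨ cong (λ l → v l j - v n j) levelP ⟩
        v m j - v n j                                   ≡⟨ split (v m j) (v (suc m) j) (v n j) ⟩
        (v m j - v (suc m) j) + + 1 * (v (suc m) j - v n j)
          ≡⟨ cong₂ (λ x y → (v x j - v (suc x) j) + + 1 * (v y j - v n j)) levelP levelQ ⟨
        (v (level P) j - v (suc (level P)) j) + + 1 * telescoped Q j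
          ≡⟨ cong₂ (λ x y → x + + 1 * y) (sym (A-row P (subst (0 ℕ.<_) (sym levelP) 0<m) j))
                   (sym (splice-above level A telescoped (λ Q<m+1 → ℕP.<-irrefl levelQ Q<m+1) j)) ⟩
        A P j + + 1 * stage (suc m) Q j
          ≡⟨ cong (_+ + 1 * stage (suc m) Q j) (splice-below level A telescoped (ℕP.≤-reflexive (cong suc levelP)) j) ⟨
        stage (suc m) P j + + 1 * stage (suc m) Q j      ∎
        where
        split : ∀ x y z → x - z ≡ (x - y) + + 1 * (y - z)
        split = solve-∀

    stage-step : ∀ {m} → 0 ℕ.< m → m ℕ.< n → det n (stage m) ≡ det n (stage (suc m))
    stage-step {m} 0<m m<n with suc m ℕ.≟ n
    ... | yes m+1≡n = det-cong (stage-last 0<m m+1≡n)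
    ... | no m+1≢n  = stage-add 0<m (ℕP.≤∧≢⇒< m<n m+1≢n)

    det-stage : ∀ d m → n ∸ m ≡ d → 0 ℕ.< m → det n (stage m) ≡ det n A
    det-stage zero m n∸m≡0 _ =
      det-cong (λ r → splice-below level A telescoped {k = m} (ℕP.<-≤-trans (level<n r) (ℕP.m∸n≡0⇒m≤n n∸m≡0)))
    det-stage (suc d) m n∸m≡d+1 0<m = trans (stage-step 0<m m<n) (det-stage d (suc m) n∸m+1≡d (ℕP.m<n⇒m<1+n 0<m))
      where
      m<n : m ℕ.< n
      m<n = ℕP.m∸n≢0⇒n<m (λ n∸m≡0 → ℕP.0≢1+n (trans (sym n∸m≡0) n∸m≡d+1))
      n∸m+1≡d : n ∸ suc m ≡ d
      n∸m+1≡d = trans (sym (ℕP.pred[m∸n]≡m∸[1+n] n m)) (cong ℕ.pred n∸m≡d+1)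

  det-telescope : ∀ {C : Mat n} → (∀ r → 0 ℕ.< level r → ∀ j → C r j ≡ v (level r) j - v n j) →
                  (∀ r → level r ≡ 0 → ∀ j → C r j ≡ A r j) → det n C ≡ det n A
  det-telescope {C} C-row C-row₀ = trans (det-cong C≡stage₁) (det-stage (n ∸ 1) 1 refl (ℕ.s≤s ℕ.z≤n))
    where
    C≡stage₁ : ∀ r j → C r j ≡ stage 1 r j
    C≡stage₁ r j with level r ℕ.≟ 0
    ... | yes r≡0 = trans (C-row₀ r r≡0 j) (sym (splice-below level A telescoped (ℕP.≤-reflexive (cong suc r≡0)) j))
    ... | no r≢0  = trans (C-row r (ℕP.n≢0⇒n>0 r≢0) j) (sym (splice-above level A telescoped (r≢0 ∘ ℕP.n<1⇒n≡0) j))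

-- Periodic functions

Periodic : ℕ → (ℤ → ℤ) → Set
Periodic b g = ∀ x → g (x + + b) ≡ g x

periodic-multiple : ∀ {b g} → Periodic b g → ∀ k x → g (x + + (k ℕ.* b)) ≡ g x
periodic-multiple {b} {g} per zero    x = cong g (ℤP.+-identityʳ x)
periodic-multiple {b} {g} per (suc k) x = begin
  g (x + + (b ℕ.+ k ℕ.* b))         ≡⟨ cong (λ y → g (x + y)) (ℤP.pos-+ b (k ℕ.* b)) ⟩
  g (x + (+ b + + (k ℕ.* b)))       ≡⟨ cong g (reassoc x (+ b) (+ (k ℕ.* b))) ⟩
  g (x + + (k ℕ.* b) + + b)         ≡⟨ per (x + + (k ℕ.* b)) ⟩
  g (x + + (k ℕ.* b))               ≡⟨ periodic-multiple per k x ⟩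
  g x                               ∎
  where
  open ≡-Reasoning
  reassoc : ∀ x y z → x + (y + z) ≡ x + z + y
  reassoc = solve-∀

I-T-periodic : ∀ {b} a {g} → Periodic b g → Periodic b (I-T a g)
I-T-periodic {b} a {g} per x = cong₂ _-_ (per x) (trans (cong g (swap x (+ b) (+ a))) (per (x + + a)))
  where
  swap : ∀ x y z → x + y + z ≡ x + z + y
  swap = solve-∀

δℤdiv-periodic : ∀ b → Periodic b (δℤdiv b)
δℤdiv-periodic b x = cong (if_then + 1 else + 0) (does-⇔ (mk⇔ cancel-b add-b) (b ℕDiv.∣? ∣ x + + b ∣) (b ℕDiv.∣? ∣ x ∣))
  where
  cancel-b : b ℕDiv.∣ ∣ x + + b ∣ → b ℕDiv.∣ ∣ x ∣
  cancel-b b∣x+b = ∣⇒∣ᵤ {+ b} {x} (∣m+n∣n⇒∣m (∣ᵤ⇒∣ {+ b} {x + + b} b∣x+b) ∣-refl)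
  add-b : b ℕDiv.∣ ∣ x ∣ → b ℕDiv.∣ ∣ x + + b ∣
  add-b b∣x = ∣⇒∣ᵤ {+ b} {x + + b} (∣m∣n⇒∣m+n (∣ᵤ⇒∣ {+ b} {x} b∣x) ∣-refl)

Sinv-periodic : ∀ b {d} (as : Vec ℕ d) → Periodic b (Sinv b as)
Sinv-periodic b []       = δℤdiv-periodic b
Sinv-periodic b (a ∷ as) = I-T-periodic a (Sinv-periodic b as)

row : ∀ {b} → (ℤ → ℤ) → ℕ → Fin b → ℤ
row g t j = g (+ t - + toℕ j)

row-mod : ∀ {b} .{{_ : NonZero b}} {g} → Periodic b g → ∀ {t t'} → t % b ≡ t' % b → ∀ j → row {b} g t j ≡ row g t' j
row-mod {b} {g} per {t} {t'} t≡t' j = trans (reduce t) (trans (cong (λ r → g (+ r - + toℕ j)) t≡t') (sym (reduce t')))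
  where
  split : ∀ r q y → r + q - y ≡ r - y + q
  split = solve-∀
  reduce : ∀ t → g (+ t - + toℕ j) ≡ g (+ (t % b) - + toℕ j)
  reduce t = begin
    g (+ t - + toℕ j)                                    ≡⟨ cong (λ s → g (+ s - + toℕ j)) (m≡m%n+[m/n]*n t b) ⟩
    g (+ (t % b ℕ.+ t / b ℕ.* b) - + toℕ j)              ≡⟨ cong (λ s → g (s - + toℕ j)) (ℤP.pos-+ (t % b) (t / b ℕ.* b)) ⟩
    g (+ (t % b) + + (t / b ℕ.* b) - + toℕ j)            ≡⟨ cong g (split (+ (t % b)) (+ (t / b ℕ.* b)) (+ toℕ j)) ⟩
    g (+ (t % b) - + toℕ j + + (t / b ℕ.* b))            ≡⟨ periodic-multiple per (t / b) _ ⟩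
    g (+ (t % b) - + toℕ j)                              ∎
    where open ≡-Reasoning

periodSum : ∀ b → (ℤ → ℤ) → ℤ → ℤ
periodSum b g x = sum (λ (i : Fin b) → g (x + + toℕ i))

module _ {n} {g : ℤ → ℤ} (per : Periodic (suc n) g) where

  periodSum-suc : ∀ x → periodSum (suc n) g (x + + 1) ≡ periodSum (suc n) g x
  periodSum-suc x = begin
    sum (λ (i : Fin (suc n)) → g (x + + 1 + + toℕ i))
      ≡⟨ sum-init-last (λ (i : Fin (suc n)) → g (x + + 1 + + toℕ i)) ⟩
    sum (λ (i : Fin n) → g (x + + 1 + + toℕ (inject₁ i))) + g (x + + 1 + + toℕ (fromℕ n))
      ≡⟨ cong₂ _+_ (sum-cong-≗ (λ (i : Fin n) → cong (λ k → g (x + + 1 + + k)) (FinP.toℕ-inject₁ i)))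
                   (cong (λ k → g (x + + 1 + + k)) (FinP.toℕ-fromℕ n)) ⟩
    S + g (x + + 1 + + n)                       ≡⟨ cong (λ z → S + g z) (ℤP.+-assoc x (+ 1) (+ n)) ⟩
    S + g (x + + suc n)                         ≡⟨ cong (_+_ S) (per x) ⟩
    S + g x                                     ≡⟨ ℤP.+-comm S (g x) ⟩
    g x + S                                     ≡⟨ cong₂ _+_ (cong g (sym (ℤP.+-identityʳ x)))
                                                             (sum-cong-≗ (λ (i : Fin n) → cong g (ℤP.+-assoc x (+ 1) (+ toℕ i)))) ⟩
    periodSum (suc n) g x                       ∎
    where
    open ≡-Reasoning
    S = sum (λ (i : Fin n) → g (x + + 1 + + toℕ i))

  periodSum-+ : ∀ x k → periodSum (suc n) g (x + + k) ≡ periodSum (suc n) g x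
  periodSum-+ x zero    = cong (periodSum (suc n) g) (ℤP.+-identityʳ x)
  periodSum-+ x (suc k) = begin
    periodSum (suc n) g (x + + suc k)        ≡⟨ cong (periodSum (suc n) g) (regroup x (+ k)) ⟩
    periodSum (suc n) g (x + + k + + 1)      ≡⟨ periodSum-suc (x + + k) ⟩
    periodSum (suc n) g (x + + k)            ≡⟨ periodSum-+ x k ⟩
    periodSum (suc n) g x                    ∎
    where
    open ≡-Reasoning
    regroup : ∀ x y → x + (+ 1 + y) ≡ x + y + + 1
    regroup = solve-∀

  rows-sum : ∀ (j : Fin (suc n)) → sum (λ (i : Fin (suc n)) → row g (suc (toℕ i)) j) ≡ periodSum (suc n) g (+ 1)
  rows-sum j = begin
    sum (λ (i : Fin (suc n)) → g (+ suc (toℕ i) - + toℕ j))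
      ≡⟨ sum-cong-≗ (λ (i : Fin (suc n)) → cong g (reorder (+ toℕ i) (+ toℕ j))) ⟩
    periodSum (suc n) g (+ 1 - + toℕ j)                      ≡⟨ periodSum-+ (+ 1 - + toℕ j) (toℕ j) ⟨
    periodSum (suc n) g (+ 1 - + toℕ j + + toℕ j)            ≡⟨ cong (periodSum (suc n) g) (cancel (+ 1) (+ toℕ j)) ⟩
    periodSum (suc n) g (+ 1)                                ∎
    where
    open ≡-Reasoning
    reorder : ∀ i j → + 1 + i - j ≡ + 1 - j + i
    reorder = solve-∀
    cancel : ∀ x j → x - j + j ≡ x
    cancel = solve-∀

lastOr : ∀ {b} → ℤ → ℤ → Fin b → ℤ
lastOr {b} x y i = if toℕ i ≡ᵇ (b ∸ 1) then x else y

lastOr-last : ∀ {n} {x y} (i : Fin (suc n)) → toℕ i ≡ n → lastOr x y i ≡ x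
lastOr-last {n} {x} {y} i i≡n = cong (if_then x else y) (dec-true (toℕ i ℕ.≟ n) i≡n)

lastOr-other : ∀ {n} {x y} (i : Fin (suc n)) → toℕ i ≢ n → lastOr x y i ≡ y
lastOr-other {n} {x} {y} i i≢n = cong (if_then x else y) (dec-false (toℕ i ℕ.≟ n) i≢n)

-- matM b as is M[ Sinv b as ] by definition.
M[_] : ∀ {b} → (ℤ → ℤ) → Mat b
M[ g ] i j = lastOr (+ 1) (g ((+ toℕ i + + 1) - + toℕ j)) i

M-row : ∀ {n} g {i : Fin (suc n)} → toℕ i ≢ n → ∀ j → M[ g ] i j ≡ row g (suc (toℕ i)) j
M-row g {i} i≢n j = trans (lastOr-other i i≢n) (cong (λ t → g (t - + toℕ j)) +i+1≡)
  where
  +i+1≡ : + toℕ i + + 1 ≡ + suc (toℕ i)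
  +i+1≡ = trans (sym (ℤP.pos-+ (toℕ i) 1)) (cong +_ (ℕP.+-comm (toℕ i) 1))

non-last<b : ∀ {n} (i : Fin (suc n)) → toℕ i ≢ n → suc (toℕ i) ℕ.< suc n
non-last<b i i≢n = ℕ.s≤s (ℕP.≤∧≢⇒< (FinP.toℕ≤pred[n] i) i≢n)

-- Row i, with t = i + 1, gets the level m ≡ t a⁻¹ (mod b), so that t ≡ m a and t + a ≡ (m + 1) a;
-- the last row has level 0.
module Levels (n a u : ℕ) (ua≡1 : (u ℕ.* a) % suc n ≡ 1) where

  private
    b = suc n

    %-absorbˡ-* : ∀ x y → ((x % b) ℕ.* y) % b ≡ (x ℕ.* y) % b
    %-absorbˡ-* x y = begin
      ((x % b) ℕ.* y) % b               ≡⟨ %-distribˡ-* (x % b) y b ⟩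
      ((x % b % b) ℕ.* (y % b)) % b     ≡⟨ cong (λ z → (z ℕ.* (y % b)) % b) (m%n%n≡m%n x b) ⟩
      ((x % b) ℕ.* (y % b)) % b         ≡⟨ %-distribˡ-* x y b ⟨
      (x ℕ.* y) % b                     ∎
      where open ≡-Reasoning

    %-absorbˡ-+ : ∀ x y → ((x % b) ℕ.+ y) % b ≡ (x ℕ.+ y) % b
    %-absorbˡ-+ x y = begin
      ((x % b) ℕ.+ y) % b               ≡⟨ %-distribˡ-+ (x % b) y b ⟩
      ((x % b % b) ℕ.+ (y % b)) % b     ≡⟨ cong (λ z → (z ℕ.+ (y % b)) % b) (m%n%n≡m%n x b) ⟩
      ((x % b) ℕ.+ (y % b)) % b         ≡⟨ %-distribˡ-+ x y b ⟨
      (x ℕ.+ y) % b                     ∎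
      where open ≡-Reasoning

    *-inverse : ∀ x → (x ℕ.* (u ℕ.* a)) % b ≡ x % b
    *-inverse x = begin
      (x ℕ.* (u ℕ.* a)) % b             ≡⟨ %-distribˡ-* x (u ℕ.* a) b ⟩
      ((x % b) ℕ.* ((u ℕ.* a) % b)) % b ≡⟨ cong (λ z → ((x % b) ℕ.* z) % b) ua≡1 ⟩
      ((x % b) ℕ.* 1) % b               ≡⟨ cong (_% b) (ℕP.*-identityʳ (x % b)) ⟩
      x % b % b                         ≡⟨ m%n%n≡m%n x b ⟩
      x % b                             ∎
      where open ≡-Reasoning

  level : Fin b → ℕ
  level i = (suc (toℕ i) ℕ.* u) % b

  level<b : ∀ i → level i ℕ.< b
  level<b i = m%n<n (suc (toℕ i) ℕ.* u) b

  level*a : ∀ i → (level i ℕ.* a) % b ≡ suc (toℕ i) % b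
  level*a i = begin
    (level i ℕ.* a) % b                        ≡⟨ %-absorbˡ-* (suc (toℕ i) ℕ.* u) a ⟩
    (suc (toℕ i) ℕ.* u ℕ.* a) % b              ≡⟨ cong (_% b) (ℕP.*-assoc (suc (toℕ i)) u a) ⟩
    (suc (toℕ i) ℕ.* (u ℕ.* a)) % b            ≡⟨ *-inverse (suc (toℕ i)) ⟩
    suc (toℕ i) % b                            ∎
    where open ≡-Reasoning

  level-succ*a : ∀ i → (suc (level i) ℕ.* a) % b ≡ (suc (toℕ i) ℕ.+ a) % b
  level-succ*a i = begin
    (a ℕ.+ level i ℕ.* a) % b                  ≡⟨ cong (_% b) (ℕP.+-comm a (level i ℕ.* a)) ⟩
    (level i ℕ.* a ℕ.+ a) % b                  ≡⟨ %-absorbˡ-+ (level i ℕ.* a) a ⟨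
    ((level i ℕ.* a) % b ℕ.+ a) % b            ≡⟨ cong (λ t → (t ℕ.+ a) % b) (level*a i) ⟩
    (suc (toℕ i) % b ℕ.+ a) % b                ≡⟨ %-absorbˡ-+ (suc (toℕ i)) a ⟩
    (suc (toℕ i) ℕ.+ a) % b                    ∎
    where open ≡-Reasoning

  level-last : ∀ i → toℕ i ≡ n → level i ≡ 0
  level-last i i≡n = trans (cong (λ t → (suc t ℕ.* u) % b) i≡n) (trans (cong (_% b) (ℕP.*-comm b u)) (m*n%n≡0 u b))

  level-non-last : ∀ i → toℕ i ≢ n → 0 ℕ.< level i
  level-non-last i i≢n = ℕP.n≢0⇒n>0 λ level≡0 → ℕP.0≢1+n (begin
    0                        ≡⟨ cong (λ l → (l ℕ.* a) % b) level≡0 ⟨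
    (level i ℕ.* a) % b      ≡⟨ level*a i ⟩
    suc (toℕ i) % b          ≡⟨ m<n⇒m%n≡m (non-last<b i i≢n) ⟩
    suc (toℕ i)              ∎)
    where open ≡-Reasoning

  0<level⇒non-last : ∀ i → 0 ℕ.< level i → toℕ i ≢ n
  0<level⇒non-last i 0<level i≡n = ℕP.<-irrefl (sym (level-last i i≡n)) 0<level

  level≡0⇒last : ∀ i → level i ≡ 0 → toℕ i ≡ n
  level≡0⇒last i level≡0 with toℕ i ℕ.≟ n
  ... | yes i≡n = i≡n
  ... | no i≢n  = contradiction level≡0 (ℕP.<⇒≢ (level-non-last i i≢n) ∘ sym)

  level-of-multiple : ∀ m → m ℕ.< b → (((m ℕ.* a) % b) ℕ.* u) % b ≡ m
  level-of-multiple m m<b = begin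
    (((m ℕ.* a) % b) ℕ.* u) % b    ≡⟨ %-absorbˡ-* (m ℕ.* a) u ⟩
    (m ℕ.* a ℕ.* u) % b            ≡⟨ cong (_% b) (trans (ℕP.*-assoc m a u) (cong (m ℕ.*_) (ℕP.*-comm a u))) ⟩
    (m ℕ.* (u ℕ.* a)) % b          ≡⟨ *-inverse m ⟩
    m % b                          ≡⟨ m<n⇒m%n≡m m<b ⟩
    m                              ∎
    where open ≡-Reasoning

  rowAt : ℕ → Fin b
  rowAt m = fromℕ< (ℕP.≤-<-trans ℕP.pred[n]≤n (m%n<n (m ℕ.* a) b))

  toℕ-rowAt : ∀ m → toℕ (rowAt m) ≡ ℕ.pred ((m ℕ.* a) % b)
  toℕ-rowAt m = FinP.toℕ-fromℕ< (ℕP.≤-<-trans ℕP.pred[n]≤n (m%n<n (m ℕ.* a) b))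

  rowAt-level : ∀ i → 0 ℕ.< level i → rowAt (level i) ≡ i
  rowAt-level i 0<level = FinP.toℕ-injective (begin
    toℕ (rowAt (level i))          ≡⟨ toℕ-rowAt (level i) ⟩
    ℕ.pred ((level i ℕ.* a) % b)   ≡⟨ cong ℕ.pred (level*a i) ⟩
    ℕ.pred (suc (toℕ i) % b)       ≡⟨ cong ℕ.pred (m<n⇒m%n≡m (non-last<b i i≢n)) ⟩
    toℕ i                          ∎)
    where
    open ≡-Reasoning
    i≢n : toℕ i ≢ n
    i≢n i≡n = ℕP.<-irrefl (sym (level-last i i≡n)) 0<level

  level-rowAt : ∀ {m} → 0 ℕ.< m → m ℕ.< b → level (rowAt m) ≡ m
  level-rowAt {m} 0<m m<b = begin
    level (rowAt m)                        ≡⟨ cong (λ t → (suc t ℕ.* u) % b) (toℕ-rowAt m) ⟩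
    (suc (ℕ.pred ((m ℕ.* a) % b)) ℕ.* u) % b ≡⟨ cong (λ t → (t ℕ.* u) % b) (ℕP.suc-pred _ {{ℕ.≢-nonZero t≢0}}) ⟩
    (((m ℕ.* a) % b) ℕ.* u) % b            ≡⟨ level-of-multiple m m<b ⟩
    m                                      ∎
    where
    open ≡-Reasoning
    t≢0 : (m ℕ.* a) % b ≢ 0
    t≢0 t≡0 = ℕP.<-irrefl (trans (cong (λ t → (t ℕ.* u) % b) (sym t≡0)) (level-of-multiple m m<b)) 0<m

-- The recurrence det M[(I − T^a) g] = b · det M[ g ]

module Recurrence (n a u : ℕ) (ua≡1 : (u ℕ.* a) % suc n ≡ 1) {g : ℤ → ℤ} (per : Periodic (suc n) g) where

  open Levels n a u ua≡1

  private
    b = suc n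

  Y : Mat b
  Y i j = lastOr (+ 1) (row g (suc (toℕ i)) j - row g b j) i

  det-telescoped : det b M[ I-T a g ] ≡ det b Y
  det-telescoped = sym (det-telescope level rowAt level-rowAt rowAt-level level<b v A-row Y-row Y-row₀)
    where
    v : ℕ → Fin b → ℤ
    v m = row g (m ℕ.* a)
    translate : ∀ t j → + t - + j + + a ≡ + (t ℕ.+ a) - + j
    translate t j = trans (reorder (+ t) (+ j) (+ a)) (cong (_- + j) (sym (ℤP.pos-+ t a)))
      where
      reorder : ∀ x y z → x - y + z ≡ x + z - y
      reorder = solve-∀
    A-row : ∀ i → 0 ℕ.< level i → ∀ j → M[ I-T a g ] i j ≡ v (level i) j - v (suc (level i)) j
    A-row i 0<level j = begin
      M[ I-T a g ] i j                                 ≡⟨ M-row (I-T a g) (0<level⇒non-last i 0<level) j ⟩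
      g (+ t - + toℕ j) - g (+ t - + toℕ j + + a)     ≡⟨ cong (λ x → g (+ t - + toℕ j) - g x) (translate t (toℕ j)) ⟩
      row g t j - row g (t ℕ.+ a) j                    ≡⟨ cong₂ _-_ (row-mod per (sym (level*a i)) j)
                                                                   (row-mod per (sym (level-succ*a i)) j) ⟩
      v (level i) j - v (suc (level i)) j              ∎
      where
      open ≡-Reasoning
      t = suc (toℕ i)
    Y-row : ∀ i → 0 ℕ.< level i → ∀ j → Y i j ≡ v (level i) j - v b j
    Y-row i 0<level j = trans (lastOr-other i (0<level⇒non-last i 0<level))
      (cong₂ _-_ (row-mod per (sym (level*a i)) j)
                 (row-mod per (trans (n%n≡0 b) (sym (trans (cong (_% b) (ℕP.*-comm b a)) (m*n%n≡0 a b)))) j))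
    Y-row₀ : ∀ i → level i ≡ 0 → ∀ j → Y i j ≡ M[ I-T a g ] i j
    Y-row₀ i level≡0 j = trans (lastOr-last i (level≡0⇒last i level≡0)) (sym (lastOr-last i (level≡0⇒last i level≡0)))

  private
    s : ℤ
    s = periodSum b g (+ 1)

    ρ : Fin b → ℤ
    ρ j = - row g b j

    κ : Fin b → ℤ
    κ = lastOr (- s) (+ 1)

    inject₁-non-last : ∀ (i : Fin n) → toℕ (inject₁ i) ≢ n
    inject₁-non-last i = FinP.toℕ-inject₁-≢ i ∘ sym

    last-one : ∀ {x : ℤ} → lastOr (+ 1) x (fromℕ n) ≡ + 1
    last-one = lastOr-last (fromℕ n) (FinP.toℕ-fromℕ n)

    non-last-rows-sum : ∀ (j : Fin b) → sum (λ (i : Fin n) → row g (suc (toℕ i)) j) ≡ s - row g b j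
    non-last-rows-sum j = begin
      Σ                                                          ≡⟨ cancel Σ (row g b j) ⟨
      Σ + row g b j - row g b j                                  ≡⟨ cong (_- row g b j) split ⟨
      sum (λ (i : Fin b) → row g (suc (toℕ i)) j) - row g b j    ≡⟨ cong (_- row g b j) (rows-sum per j) ⟩
      s - row g b j                                              ∎
      where
      open ≡-Reasoning
      Σ = sum (λ (i : Fin n) → row g (suc (toℕ i)) j)
      cancel : ∀ x y → x + y - y ≡ x
      cancel = solve-∀
      split : sum (λ (i : Fin b) → row g (suc (toℕ i)) j) ≡ Σ + row g b j
      split = trans (sum-init-last (λ (i : Fin b) → row g (suc (toℕ i)) j))
                    (cong₂ _+_ (sum-cong-≗ (λ (i : Fin n) → cong (λ k → row g (suc k) j) (FinP.toℕ-inject₁ i)))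
                               (cong (λ k → row g (suc k) j) (FinP.toℕ-fromℕ n)))

    κ-combination : ∀ (X : Mat b) → (∀ j → X (fromℕ n) j ≡ + 1) →
                    ∀ j → sum (λ q → κ q * X q j) ≡ sum (λ (i : Fin n) → X (inject₁ i) j) - s
    κ-combination X last≡1 j = begin
      sum (λ q → κ q * X q j)                                                   ≡⟨ sum-init-last (λ q → κ q * X q j) ⟩
      sum (λ (i : Fin n) → κ (inject₁ i) * X (inject₁ i) j) + κ (fromℕ n) * X (fromℕ n) j
        ≡⟨ cong₂ _+_ (sum-cong-≗ (λ (i : Fin n) → trans (cong (_* X (inject₁ i) j) (lastOr-other (inject₁ i) (inject₁-non-last i)))
                                                          (ℤP.*-identityˡ _)))
                     (cong₂ _*_ (lastOr-last (fromℕ n) (FinP.toℕ-fromℕ n)) (last≡1 j)) ⟩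
      sum (λ (i : Fin n) → X (inject₁ i) j) + - s * + 1
        ≡⟨ cong (_+_ (sum (λ (i : Fin n) → X (inject₁ i) j))) (ℤP.*-identityʳ (- s)) ⟩
      sum (λ (i : Fin n) → X (inject₁ i) j) - s                                 ∎
      where open ≡-Reasoning

    κ-combination-Y : ∀ j → sum (λ q → κ q * Y q j) ≡ + b * ρ j
    κ-combination-Y j = begin
      sum (λ q → κ q * Y q j)                                            ≡⟨ κ-combination Y (λ _ → last-one) j ⟩
      sum (λ (i : Fin n) → Y (inject₁ i) j) - s                          ≡⟨ cong (_- s) (sum-cong-≗ Y-inject₁) ⟩
      sum (λ (i : Fin n) → row g (suc (toℕ i)) j - row g b j) - s
        ≡⟨ cong (_- s) (sum-minus-const (λ (i : Fin n) → row g (suc (toℕ i)) j) (row g b j)) ⟩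
      sum (λ (i : Fin n) → row g (suc (toℕ i)) j) - + n * row g b j - s  ≡⟨ cong (λ x → x - + n * row g b j - s) (non-last-rows-sum j) ⟩
      s - row g b j - + n * row g b j - s                                ≡⟨ collect s (row g b j) (+ n) ⟩
      + b * ρ j                                                          ∎
      where
      open ≡-Reasoning
      Y-inject₁ : ∀ i → Y (inject₁ i) j ≡ row g (suc (toℕ i)) j - row g b j
      Y-inject₁ i = trans (lastOr-other (inject₁ i) (inject₁-non-last i))
                          (cong (λ k → row g (suc k) j - row g b j) (FinP.toℕ-inject₁ i))
      collect : ∀ s r m → s - r - m * r - s ≡ (+ 1 + m) * - r
      collect = solve-∀

    κ-combination-M : ∀ j → sum (λ q → κ q * M[ g ] q j) ≡ ρ j
    κ-combination-M j = begin
      sum (λ q → κ q * M[ g ] q j)                             ≡⟨ κ-combination M[ g ] (λ _ → last-one) j ⟩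
      sum (λ (i : Fin n) → M[ g ] (inject₁ i) j) - s           ≡⟨ cong (_- s) (sum-cong-≗ M-inject₁) ⟩
      sum (λ (i : Fin n) → row g (suc (toℕ i)) j) - s          ≡⟨ cong (_- s) (non-last-rows-sum j) ⟩
      s - row g b j - s                                        ≡⟨ cancel s (row g b j) ⟩
      ρ j                                                      ∎
      where
      open ≡-Reasoning
      M-inject₁ : ∀ i → M[ g ] (inject₁ i) j ≡ row g (suc (toℕ i)) j
      M-inject₁ i = trans (M-row g (inject₁-non-last i) j) (cong (λ k → row g (suc k) j) (FinP.toℕ-inject₁ i))
      cancel : ∀ s r → s - r - s ≡ - r
      cancel = solve-∀

    Y≡M+ρ : ∀ r j → Y r j ≡ M[ g ] r j + lastOr (+ 0) (+ 1) r * ρ j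
    Y≡M+ρ r j with toℕ r ℕ.≟ n
    ... | yes r≡n = trans (lastOr-last r r≡n)
                          (trans (add-zero (ρ j)) (sym (cong₂ (λ x w → x + w * ρ j) (lastOr-last r r≡n) (lastOr-last r r≡n))))
      where
      add-zero : ∀ x → + 1 ≡ + 1 + + 0 * x
      add-zero = solve-∀
    ... | no r≢n  = trans (lastOr-other r r≢n)
                          (trans (add-one (row g (suc (toℕ r)) j) (row g b j))
                                 (sym (cong₂ (λ x w → x + w * ρ j) (M-row g r≢n j) (lastOr-other r r≢n))))
      where
      add-one : ∀ x y → x - y ≡ x + + 1 * - y
      add-one = solve-∀

    unchanged-off-0 : ∀ (X : Mat b) {v} → SameRowsExcept zero X (X [ zero ]≔ v)
    unchanged-off-0 X {v} r r≢0 j = sym (row-unchanged X v r≢0 j)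

  -- With ρ = − row g b and κ = (1, …, 1, −s), Σ κ_q Y_q = b ρ and Σ κ_q M[ g ]_q = ρ. Once row 0
  -- of Y and of M[ g ] is replaced by ρ, the two matrices differ by multiples of row 0.
  det-Y : 0 ℕ.< n → det b Y ≡ + b * det b M[ g ]
  det-Y 0<n = begin
    det b Y                                  ≡⟨ trans (cong (_* det b Y) κ₀) (ℤP.*-identityˡ (det b Y)) ⟨
    κ zero * det b Y                         ≡⟨ det-combination zero κ (unchanged-off-0 Y) bρ-row ⟨
    det b (Y [ zero ]≔ bρ)                   ≡⟨ det-scale zero (+ b) (λ r r≢0 j → trans (row-unchanged Y ρ r≢0 j) (sym (row-unchanged Y bρ r≢0 j)))
                                                  (λ j → trans (row-updated Y zero bρ j) (cong (+ b *_) (sym (row-updated Y zero ρ j)))) ⟩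
    + b * det b (Y [ zero ]≔ ρ)          ≡⟨ cong (+ b *_) clear-row₀ ⟩
    + b * det b (M[ g ] [ zero ]≔ ρ)     ≡⟨ cong (+ b *_) (det-combination zero κ (unchanged-off-0 M[ g ]) ρ-row) ⟩
    + b * (κ zero * det b M[ g ])        ≡⟨ cong (+ b *_) (trans (cong (_* det b M[ g ]) κ₀) (ℤP.*-identityˡ (det b M[ g ]))) ⟩
    + b * det b M[ g ]                   ∎
    where
    open ≡-Reasoning
    κ₀ : κ zero ≡ + 1
    κ₀ = lastOr-other zero (ℕP.<⇒≢ 0<n)
    bρ : Fin b → ℤ
    bρ j = + b * ρ j
    bρ-row : ∀ j → (Y [ zero ]≔ bρ) zero j ≡ sum (λ q → κ q * Y q j)
    bρ-row j = trans (row-updated Y zero bρ j) (sym (κ-combination-Y j))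
    ρ-row : ∀ j → (M[ g ] [ zero ]≔ ρ) zero j ≡ sum (λ q → κ q * M[ g ] q j)
    ρ-row j = trans (row-updated M[ g ] zero ρ j) (sym (κ-combination-M j))
    clear-row₀ : det b (Y [ zero ]≔ ρ) ≡ det b (M[ g ] [ zero ]≔ ρ)
    clear-row₀ = det-add-multiples-of-row zero (lastOr (+ 0) (+ 1)) {M[ g ] [ zero ]≔ ρ} {Y [ zero ]≔ ρ}
      (λ j → trans (row-updated Y zero ρ j) (sym (row-updated M[ g ] zero ρ j)))
      (λ r r≢0 j → trans (row-unchanged Y ρ r≢0 j)
                     (trans (Y≡M+ρ r j) (sym (cong₂ (λ x y → x + lastOr (+ 0) (+ 1) r * y)
                                                   (row-unchanged M[ g ] ρ r≢0 j) (row-updated M[ g ] zero ρ j)))))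

  det-I-T : 0 ℕ.< n → det b M[ I-T a g ] ≡ + b * det b M[ g ]
  det-I-T 0<n = trans det-telescoped (det-Y 0<n)

-- The base case g = δ and the theorem

shift : ∀ n → Mat n
shift n i j = lastOr (+ 1) (if toℕ j ≡ᵇ suc (toℕ i) then + 1 else + 0) i

det-shift : ∀ n → det (suc n) (shift (suc n)) ≡ sign n
det-shift zero    = refl
det-shift (suc n) = begin
  det (suc (suc n)) (shift (suc (suc n)))           ≡⟨ det-expand (shift (suc (suc n))) ⟩
  sum (expansionTerm (shift (suc (suc n))))         ≡⟨ sum-single _ (suc zero) off-superdiagonal ⟩
  sign 1 * + 1 * det (suc n) (minor (shift (suc (suc n))) (suc zero))
    ≡⟨ cong (sign 1 * + 1 *_) (det-cong minor≡shift) ⟩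
  sign 1 * + 1 * det (suc n) (shift (suc n))        ≡⟨ cong (sign 1 * + 1 *_) (det-shift n) ⟩
  sign 1 * + 1 * sign n                             ≡⟨ simplify (sign n) ⟩
  sign (suc n)                                      ∎
  where
  open ≡-Reasoning
  simplify : ∀ x → - + 1 * + 1 * + 1 * x ≡ - + 1 * x
  simplify = solve-∀
  zero-entry : ∀ s x → s * + 0 * x ≡ + 0
  zero-entry s x = trans (cong (_* x) (ℤP.*-zeroʳ s)) (ℤP.*-zeroˡ x)
  off-superdiagonal : ∀ j → j ≢ suc zero → expansionTerm (shift (suc (suc n))) j ≡ + 0
  off-superdiagonal zero          _   = zero-entry (sign 0) (det (suc n) (minor (shift (suc (suc n))) zero))
  off-superdiagonal (suc zero)    j≢1 = contradiction refl j≢1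
  off-superdiagonal (suc (suc j)) _   =
    zero-entry (sign (toℕ (suc (suc j)))) (det (suc n) (minor (shift (suc (suc n))) (suc (suc j))))
  minor≡shift : ∀ r c → minor (shift (suc (suc n))) (suc zero) r c ≡ shift (suc n) r c
  minor≡shift r zero    = refl
  minor≡shift r (suc c) = refl

δℤdiv-below : ∀ {b x y} → x ℕ.< b → y ℕ.< b → δℤdiv b (+ x - + y) ≡ (if y ≡ᵇ x then + 1 else + 0)
δℤdiv-below {b} {x} {y} x<b y<b with y ℕ.≟ x
... | yes refl = cong (if_then + 1 else + 0) (trans (cong (λ z → does (b ℕDiv.∣? ∣ z ∣)) (ℤP.+-inverseʳ (+ x)))
                                                    (trans (dec-true (b ℕDiv.∣? 0) (b ℕDiv.∣0)) (sym (dec-true (x ℕ.≟ x) refl))))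
... | no y≢x   = cong (if_then + 1 else + 0) (trans (dec-false (b ℕDiv.∣? ∣ + x - + y ∣) b∤x-y) (sym (dec-false (y ℕ.≟ x) y≢x)))
  where
  x-y≢0 : ∣ + x - + y ∣ ≢ 0
  x-y≢0 = y≢x ∘ sym ∘ ℤP.+-injective ∘ ℤP.i-j≡0⇒i≡j (+ x) (+ y) ∘ ℤP.∣i∣≡0⇒i≡0
  x-y<b : ∣ + x - + y ∣ ℕ.< b
  x-y<b = ℕP.≤-<-trans (subst (ℕ._≤ x ℕ.⊔ y) (cong ∣_∣ (sym (ℤP.[+m]-[+n]≡m⊖n x y))) (ℤP.∣m⊝n∣≤m⊔n x y))
                       (ℕP.⊔-pres-<m x<b y<b)
  b∤x-y = ℕDiv.>⇒∤ {{ℕ.≢-nonZero x-y≢0}} x-y<b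

M[δ]≡shift : ∀ n i j → M[ δℤdiv (suc n) ] i j ≡ shift (suc n) i j
M[δ]≡shift n i j with toℕ i ℕ.≟ n
... | yes i≡n = trans (lastOr-last i i≡n) (sym (lastOr-last i i≡n))
... | no i≢n  = trans (M-row (δℤdiv (suc n)) i≢n j)
                      (trans (δℤdiv-below (non-last<b i i≢n) (FinP.toℕ<n j)) (sym (lastOr-other i i≢n)))

modular-inverse : ∀ {k a} → Coprime a (suc (suc k)) → ∃[ u ] (u ℕ.* a) % suc (suc k) ≡ 1
modular-inverse {k} {a} coprime with coprime-Bézout coprime
... | Bézout.+- x y eq = x , (begin
  (x ℕ.* a) % b                   ≡⟨ cong (_% b) eq ⟨
  (1 ℕ.+ y ℕ.* b) % b             ≡⟨ [m+kn]%n≡m%n 1 y b ⟩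
  1                               ∎)
  where
  open ≡-Reasoning
  b = suc (suc k)
-- Here x a ≡ −1 (mod b), so (b − 1) x is an inverse.
... | Bézout.-+ x y eq = suc k ℕ.* x , (begin
  (suc k ℕ.* x ℕ.* a) % b                 ≡⟨ [m+kn]%n≡m%n (suc k ℕ.* x ℕ.* a) 1 b ⟨
  (suc k ℕ.* x ℕ.* a ℕ.+ 1 ℕ.* b) % b     ≡⟨ cong (_% b) (trans (regroup k x a) (cong (λ z → 1 ℕ.+ suc k ℕ.* z) eq)) ⟩
  (1 ℕ.+ suc k ℕ.* (y ℕ.* b)) % b         ≡⟨ cong (λ z → (1 ℕ.+ z) % b) (ℕP.*-assoc (suc k) y b) ⟨
  (1 ℕ.+ suc k ℕ.* y ℕ.* b) % b           ≡⟨ [m+kn]%n≡m%n 1 (suc k ℕ.* y) b ⟩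
  1                                       ∎)
  where
  open ≡-Reasoning
  b = suc (suc k)
  regroup : ∀ k x a → suc k ℕ.* x ℕ.* a ℕ.+ 1 ℕ.* suc (suc k) ≡ 1 ℕ.+ suc k ℕ.* (1 ℕ.+ x ℕ.* a)
  regroup = ℕ-Solver.solve-∀

det-M-Sinv : ∀ k {d} (as : Vec ℕ d) → (∀ i → Coprime (lookup as i) (suc (suc k))) →
             det (suc (suc k)) M[ Sinv (suc (suc k)) as ] ≡ sign (suc k) * (+ suc (suc k)) ^ d
det-M-Sinv k [] _ = trans (det-cong (M[δ]≡shift (suc k))) (trans (det-shift (suc k)) (sym (ℤP.*-identityʳ _)))
det-M-Sinv k {suc d} (a ∷ as) coprime with modular-inverse (coprime zero)
... | u , ua≡1 = begin
  det b M[ I-T a (Sinv b as) ]       ≡⟨ Recurrence.det-I-T (suc k) a u ua≡1 (Sinv-periodic b as) (s≤s z≤n) ⟩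
  + b * det b M[ Sinv b as ]         ≡⟨ cong (+ b *_) (det-M-Sinv k as (coprime ∘ suc)) ⟩
  + b * (sign (suc k) * (+ b) ^ d)   ≡⟨ swap (+ b) (sign (suc k)) ((+ b) ^ d) ⟩
  sign (suc k) * (+ b * (+ b) ^ d)   ∎
  where
  open ≡-Reasoning
  b = suc (suc k)
  swap : ∀ x y z → x * (y * z) ≡ y * (x * z)
  swap = solve-∀

proposition12 : (d b : ℕ) → 1 ≤ d → 2 ≤ b → (a : Vec ℕ d) →
    (∀ (k : Fin d) → 1 ≤ lookup a k) →
    (∀ (k : Fin d) → Coprime (lookup a k) b) →
    det b (matM b a) ≡ ((- + 1) ^ (b Data.Nat.∸ 1)) * ((+ b) ^ d)
proposition12 d (suc (suc k)) _ (s≤s (s≤s z≤n)) a _ coprime = det-M-Sinv k a coprime
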